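{- Let $d\in\mathbb{N}$, let $G$ be a graph, $A\subseteq V(G)$, $H$ a connected component of $G-A$, and $H'=G[V(H)\cup A]$. Let $H^\star$ be a graph with a set $A^\star\subseteq V(H^\star)$ such that $H^\star-A^\star=H$ and $N_{H^\star}(A^\star)=N_{H'}(A)$. Then for any two vertices $u,v\in V(H)$ with $\mathsf{dist}_{H^\star}(u,A^\star)>\lfloor d/2\rfloor$, $\mathsf{dist}_{H^\star}(v,A^\star)>\lfloor d/2\rfloor$, and $\mathsf{dist}_{H^\star}(u,v)>d$, we have $\mathsf{dist}_G(u,v)>d$.
   Context: $\mathsf{dist}_K$ denotes shortest-path distance in a graph $K$ (infinite between different components), and $\mathsf{dist}_K(u,Z)=\min_{z\in Z}\mathsf{dist}_K(u,z)$. For a vertex set $Z$ of $K$, $N_K(Z)$ is the set of vertices outside $Z$ adjacent to some vertex of $Z$. -}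

module Defs where

open import Data.Nat using (ℕ; zero; suc; _≤_)
open import Data.Fin using (Fin)
open import Data.Product using (Σ; ∃; _×_; _,_)
open import Data.Sum using (_⊎_)
open import Data.Empty using (⊥)
open import Relation.Nullary using (¬_)
open import Relation.Binary.PropositionalEquality using (_≡_)
open import Function.Bundles using (_⇔_)

record Graph (n : ℕ) : Set₁ where
  field
    Adj    : Fin n → Fin n → Set
    sym    : ∀ {x y} → Adj x y → Adj y x
    irrefl : ∀ {x} → Adj x x → ⊥
open Graph public

VSet : ℕ → Set₁
VSet n = Fin n → Set

_⊆_ : ∀ {n} → VSet n → VSet n → Set
S ⊆ T = ∀ x → S x → T x

_∪_ : ∀ {n} → VSet n → VSet n → VSet n
(S ∪ T) x = S x ⊎ T x

-- Induced subgraph G[S], kept on the same vertex type; vertices outside S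
-- are isolated and never used (we only look at walks between S-vertices).
induced : ∀ {n} → Graph n → VSet n → Graph n
induced G S = record
  { Adj    = λ x y → S x × S y × Adj G x y
  ; sym    = λ { (sx , sy , e) → sy , sx , sym G e }
  ; irrefl = λ { (_ , _ , e) → irrefl G e } }

data Walk {n} (G : Graph n) : Fin n → Fin n → ℕ → Set where
  nil  : ∀ x → Walk G x x zero
  cons : ∀ {x y z k} → Adj G x y → Walk G y z k → Walk G x (z) (suc k)

DistLe : ∀ {n} → Graph n → Fin n → Fin n → ℕ → Set
DistLe G u v k = Σ ℕ λ l → l ≤ k × Walk G u v l

-- dist_G(u,v) > k   (also true when u,v are in different components: dist = ∞)
DistGt : ∀ {n} → Graph n → Fin n → Fin n → ℕ → Set
DistGt G u v k = ¬ DistLe G u v k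

DistSetGt : ∀ {n} → Graph n → Fin n → VSet n → ℕ → Set
DistSetGt G u Z k = ∀ z → Z z → DistGt G u z k

Connected : ∀ {n} → Graph n → VSet n → Set
Connected G S = ∀ x y → S x → S y → Σ ℕ λ k → Walk (induced G S) x y k

IsComponentMinus : ∀ {n} → Graph n → VSet n → VSet n → Set₁
IsComponentMinus {n} G A C =
  (C ⊆ (λ x → ¬ A x)) ×
  (Σ (Fin n) C) ×
  Connected G C ×
  (∀ (D : VSet n) → D ⊆ (λ x → ¬ A x) → C ⊆ D → Connected G D → D ⊆ C)

Nbhd : ∀ {n} → Graph n → VSet n → VSet n
Nbhd {n} K Z x = ¬ Z x × Σ (Fin n) λ z → Z z × Adj K x z

-- H⋆ - A⋆ = H, where H = G[C], via the identification φ : V(H) → V(H⋆) ∖ A⋆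
-- (φ restricted to C is a bijection onto V(H⋆)∖A⋆ preserving and reflecting adjacency).
DeletionIs : ∀ {n m} → Graph m → VSet m → Graph n → VSet n → (Fin n → Fin m) → Set
DeletionIs {n} {m} Hs As G C φ =
  (∀ x → C x → ¬ As (φ x)) ×
  (∀ x y → C x → C y → φ x ≡ φ y → x ≡ y) ×
  (∀ w → ¬ As w → Σ (Fin n) λ x → C x × φ x ≡ w) ×
  (∀ x y → C x → C y → (Adj Hs (φ x) (φ y) ⇔ Adj G x y))

{-# OPTIONS --safe #-}
-- Follow a short walk u ⇝ v of G. While it stays in the component C it is, via φ,
-- a walk of H⋆ of the same length, so it cannot reach v inside C. Hence it leaves C,
-- and by maximality of C its first step out lands in A; the vertex just before lies
-- in N(A), so its image is adjacent to A⋆. Doing the same from v along the reversed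
-- walk gives two disjoint pieces of the walk, each longer than ⌊d/2⌋ because u and v
-- are far from A⋆, so the walk is longer than d.
module Submission where

open import Defs
open import Data.Nat using (ℕ; ⌊_/2⌋; zero; suc; _+_; _≤_; _<_; s≤s; z≤n)
open import Data.Nat.Properties
  using (+-suc; +-comm; ≤-refl; ≤-trans; <-≤-trans; ≰⇒>; <⇒≱; +-mono-≤; +-monoʳ-≤; m+n≤o⇒m≤o)
open import Data.Fin using (Fin)
open import Data.Product using (Σ; _×_; _,_; proj₁; proj₂)
open import Data.Sum using (_⊎_; inj₁; inj₂)
open import Function using (_∘_)
open import Function.Bundles using (Equivalence)
open import Relation.Nullary using (¬_; yes; no)
open import Relation.Nullary.Decidable using (¬¬-excluded-middle)
open import Relation.Binary.PropositionalEquality using (_≡_; refl; subst)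

n<[1+⌊n/2⌋]+[1+⌊n/2⌋] : ∀ n → n < suc ⌊ n /2⌋ + suc ⌊ n /2⌋
n<[1+⌊n/2⌋]+[1+⌊n/2⌋] zero          = s≤s z≤n
n<[1+⌊n/2⌋]+[1+⌊n/2⌋] (suc zero)    = s≤s (s≤s z≤n)
n<[1+⌊n/2⌋]+[1+⌊n/2⌋] (suc (suc n))
  rewrite +-suc (suc ⌊ n /2⌋) (suc ⌊ n /2⌋) = s≤s (s≤s (n<[1+⌊n/2⌋]+[1+⌊n/2⌋] n))

⌊n/2⌋<i⇒⌊n/2⌋<j⇒n<i+j : ∀ n {i j} → ⌊ n /2⌋ < i → ⌊ n /2⌋ < j → n < i + j
⌊n/2⌋<i⇒⌊n/2⌋<j⇒n<i+j n p q = <-≤-trans (n<[1+⌊n/2⌋]+[1+⌊n/2⌋] n) (+-mono-≤ p q)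

module _ {n} {K : Graph n} where

  _++ʷ_ : ∀ {x y z i j} → Walk K x y i → Walk K y z j → Walk K x z (i + j)
  nil _    ++ʷ V = V
  cons e W ++ʷ V = cons e (W ++ʷ V)

  reverse : ∀ {x y k} → Walk K x y k → Walk K y x k
  reverse (nil x)            = nil x
  reverse (cons {k = k} e W) =
    subst (Walk K _ _) (+-comm k 1) (reverse W ++ʷ cons (sym K e) (nil _))

  DistSetGt-walk : ∀ {x z k i} {Z : VSet n} → DistSetGt K x Z k → Z z → Walk K x z i → k < i
  DistSetGt-walk far z∈Z W = ≰⇒> (λ i≤k → far _ z∈Z (_ , i≤k , W))

induced-mono : ∀ {n} {G : Graph n} {S T : VSet n} → S ⊆ T →
               ∀ {x y k} → Walk (induced G S) x y k → Walk (induced G T) x y k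
induced-mono S⊆T (nil x)                 = nil x
induced-mono S⊆T (cons (x∈S , y∈S , e) W) = cons (S⊆T _ x∈S , S⊆T _ y∈S , e) (induced-mono S⊆T W)

component-adj-closed : ∀ {n} {G : Graph n} {A C : VSet n} → IsComponentMinus G A C →
                       ∀ {x y} → C x → Adj G x y → ¬ A y → C y
component-adj-closed {n} {G} {A} {C} (C⊆∁A , _ , C-conn , C-max) {x} {y} x∈C e y∉A =
  C-max C+y C+y⊆∁A (λ _ → inj₁) C+y-conn y (inj₂ refl)
  where
  C+y : VSet n
  C+y t = C t ⊎ t ≡ y

  C+y⊆∁A : C+y ⊆ (λ t → ¬ A t)
  C+y⊆∁A t (inj₁ t∈C) = C⊆∁A t t∈C
  C+y⊆∁A t (inj₂ refl) = y∉A

  walk-in-C : ∀ a b → C a → C b → Σ ℕ (Walk (induced G C+y) a b)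
  walk-in-C a b a∈C b∈C = let k , W = C-conn a b a∈C b∈C in k , induced-mono (λ _ → inj₁) W

  step : Adj (induced G C+y) x y
  step = inj₁ x∈C , inj₂ refl , e

  C+y-conn : Connected G C+y
  C+y-conn a b (inj₁ a∈C)  (inj₁ b∈C)  = walk-in-C a b a∈C b∈C
  C+y-conn a b (inj₁ a∈C)  (inj₂ refl) =
    let _ , W = walk-in-C a x a∈C x∈C in _ , W ++ʷ cons step (nil y)
  C+y-conn a b (inj₂ refl) (inj₁ b∈C)  =
    let _ , W = walk-in-C x b x∈C b∈C in _ , cons (sym (induced G C+y) step) W
  C+y-conn a b (inj₂ refl) (inj₂ refl) = zero , nil y

module FirstExit {n m} {G : Graph n} {A C : VSet n} {H⋆ : Graph m} {A⋆ : VSet m} {φ : Fin n → Fin m}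
  (C-closed : ∀ {x y} → C x → Adj G x y → ¬ A y → C y)
  (φ-adj    : ∀ {x y} → C x → C y → Adj G x y → Adj H⋆ (φ x) (φ y))
  (φ-touch  : ∀ {x y} → C x → Adj G x y → A y → Σ (Fin m) λ a → A⋆ a × Adj H⋆ (φ x) a)
  where

  data Transfer (x y : Fin n) (k : ℕ) : Set where
    inside : C y → Walk H⋆ (φ x) (φ y) k → Transfer x y k
    exits  : ∀ {a w i j} → A⋆ a → Walk H⋆ (φ x) a i → A w → Walk G w y j → i + j ≤ k →
             Transfer x y k

  private
    prepend : ∀ {x y z k} → Adj H⋆ (φ x) (φ y) → Transfer y z k → Transfer x z (suc k)
    prepend e (inside z∈C W⋆)             = inside z∈C (cons e W⋆)
    prepend e (exits a∈A⋆ W⋆ w∈A W i+j≤k) = exits a∈A⋆ (cons e W⋆) w∈A W (s≤s i+j≤k)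

  -- Membership in A is not decidable, so the first exit from C is only found under
  -- double negation.
  transfer : ∀ {x y k} → C x → Walk G x y k → ¬ ¬ Transfer x y k
  transfer x∈C (nil x)    ¬t = ¬t (inside x∈C (nil (φ x)))
  transfer x∈C (cons e W) ¬t = ¬¬-excluded-middle λ where
    (yes y∈A) → let a , a∈A⋆ , e⋆ = φ-touch x∈C e y∈A in
                ¬t (exits a∈A⋆ (cons e⋆ (nil a)) y∈A W ≤-refl)
    (no y∉A)  → let y∈C = C-closed x∈C e y∉A in
                transfer y∈C W (¬t ∘ prepend (φ-adj x∈C y∈C e))

-- Only the inclusion N_{H'}(A) → N_{H⋆}(A⋆) is needed; the converse hypothesis is unused.
mainTheorem12 : ∀ (d : ℕ) {n m : ℕ} (G : Graph n) (A C : VSet n)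
    → IsComponentMinus G A C
    → (Hs : Graph m) (As : VSet m) (φ : Fin n → Fin m)
    → DeletionIs Hs As G C φ
    → (∀ x → Nbhd (induced G (C ∪ A)) A x → Nbhd Hs As (φ x))
    → (∀ w → Nbhd Hs As w → Σ (Fin n) λ x → Nbhd (induced G (C ∪ A)) A x × φ x ≡ w)
    → ∀ u v → C u → C v
    → DistSetGt Hs (φ u) As ⌊ d /2⌋
    → DistSetGt Hs (φ v) As ⌊ d /2⌋
    → DistGt Hs (φ u) (φ v) d
    → DistGt G u v d
mainTheorem12 d {m = m} G A C comp H⋆ A⋆ φ del toNbhd _ u v u∈C v∈C u-far v-far uv-far (l , l≤d , W) =
  transfer u∈C W λ where
    (inside _ W⋆) → uv-far (l , l≤d , W⋆)
    (exits {i = i} a∈A⋆ W⋆ w∈A W′ i+j≤l) → transfer v∈C (reverse W′) λ where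
      (inside w∈C _) → proj₁ comp _ w∈C w∈A
      (exits {i = i′} a′∈A⋆ W⋆′ _ _ i′+j′≤j) →
        <⇒≱ (⌊n/2⌋<i⇒⌊n/2⌋<j⇒n<i+j d (DistSetGt-walk u-far a∈A⋆ W⋆) (DistSetGt-walk v-far a′∈A⋆ W⋆′))
            (≤-trans (+-monoʳ-≤ i (m+n≤o⇒m≤o i′ i′+j′≤j)) (≤-trans i+j≤l l≤d))
  where
  φ-adj : ∀ {x y} → C x → C y → Adj G x y → Adj H⋆ (φ x) (φ y)
  φ-adj x∈C y∈C = Equivalence.from (proj₂ (proj₂ (proj₂ del)) _ _ x∈C y∈C)

  φ-touch : ∀ {x y} → C x → Adj G x y → A y → Σ (Fin m) λ a → A⋆ a × Adj H⋆ (φ x) a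
  φ-touch {x} {y} x∈C e y∈A =
    proj₂ (toNbhd x (proj₁ comp x x∈C , y , y∈A , inj₁ x∈C , inj₂ y∈A , e))

  open FirstExit {H⋆ = H⋆} {A⋆ = A⋆} {φ = φ} (component-adj-closed comp) φ-adj φ-touch
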